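{- Let $\mathcal{P}$ be an abstract $n$-polytope, let $\Phi$ be a flag of $\mathcal{P}$ and let $P$ be the Petrie polygon containing $\Phi$, of length $\ell$. Let $S=\{\Psi_i\}_{i=0}^{n\ell-1}$ be the sequence of flags defined by $\Psi_0=\Phi$ and $\Psi_{i+1}=r_i\Psi_i$ for $0\le i\le n\ell$, where the subscript of $r_i$ is taken modulo $n$ and the subscript of $\Psi_i$ modulo $n\ell$. If $P$ is simple, then all the elements of $S$ are different.
   Context: An $n$-maniplex is a connected simple graph whose edges are colored with $\{0,\dots,n-1\}$ so that each vertex (flag) is incident to exactly one edge of each color and for $|i-j|>1$ alternating paths of length 4 in colors $i,j$ are closed. $r_i$ is the permutation of flags sending a flag to the flag joined to it by its edge of color $i$; these permutations compose as functions acting on the left. The $i$-faces are the connected components of the graph obtained by deleting the edges of color $i$; $0$-faces are vertices. An abstract $n$-polytope is an $n$-maniplex satisfying: if two flags are joined by a path with colors in $[0,m]$ and by a path with colors in $[k,n-1]$, then they are joined by a path with colors in $[k,m]$. A Petrie polygon is an orbit of flags under the permutation $\omega=r_{n-1}r_{n-2}\cdots r_0$; its length is its number of flags; it is simple if any two distinct flags in it lie in distinct $0$-faces. -}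

module Defs where

open import Data.Nat using (ℕ; zero; suc; _+_; _*_; _≤_; _<_)
open import Data.Nat.DivMod using (_mod_)
open import Data.Fin using (Fin; toℕ)
open import Data.Product using (Σ; ∃; _×_)
open import Data.Unit using (⊤)
open import Data.List using (List; length)
open import Data.List.Membership.Propositional using (_∈_)
open import Data.List.Relation.Unary.Unique.Propositional using (Unique)
open import Relation.Binary.PropositionalEquality using (_≡_; _≢_)
open import Relation.Nullary using (¬_)
open import Function using (id; _⇔_)

data Path {n : ℕ} {F : Set} (r : Fin n → F → F) (P : Fin n → Set) : F → F → Set where
  here : ∀ {x} → Path r P x x
  step : ∀ {x y} (i : Fin n) → P i → Path r P (r i x) y → Path r P x y

-- An n-maniplex, given by its flags and the "colour-i neighbour" maps r i.
record Maniplex (n : ℕ) : Set₁ where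
  field
    Flag    : Set
    r       : Fin n → Flag → Flag
    -- each flag is incident to exactly one edge of colour i (perfect matching)
    invol   : ∀ i x → r i (r i x) ≡ x
    noLoop  : ∀ i x → r i x ≢ x
    noMulti : ∀ i j x → i ≢ j → r i x ≢ r j x
    closed4 : ∀ i j → suc (toℕ i) < toℕ j → ∀ x →
              (r i (r j (r i (r j x))) ≡ x) × (r j (r i (r j (r i x))) ≡ x)

    connected : ∀ x y → Path r (λ _ → ⊤) x y

open Maniplex public

-- the diamond / strong flag-connectivity condition defining abstract polytopes
IsPolytope : ∀ {n} → Maniplex n → Set
IsPolytope {n} M = ∀ (k m : ℕ) (x y : Flag M) →
  Path (r M) (λ i → toℕ i ≤ m) x y →
  Path (r M) (λ i → k ≤ toℕ i) x y →
  Path (r M) (λ i → (k ≤ toℕ i) × (toℕ i ≤ m)) x y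

Same0Face : ∀ {n} (M : Maniplex n) → Flag M → Flag M → Set
Same0Face M x y = Path (r M) (λ i → 1 ≤ toℕ i) x y

rmod : ∀ {n} (M : Maniplex n) → ℕ → Flag M → Flag M
rmod {zero}  M i = id
rmod {suc n} M i = r M (i mod suc n)

walk : ∀ {n} (M : Maniplex n) → ℕ → Flag M → Flag M
walk M zero    x = x
walk M (suc k) x = rmod M k (walk M k x)

ω : ∀ {n} (M : Maniplex n) → Flag M → Flag M
ω {n} M = walk M n

ωpow : ∀ {n} (M : Maniplex n) → ℕ → Flag M → Flag M
ωpow M zero    x = x
ωpow M (suc k) x = ω M (ωpow M k x)

InPetrie : ∀ {n} (M : Maniplex n) → Flag M → Flag M → Set
InPetrie M Φ y = ∃ λ k → ωpow M k Φ ≡ y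

PetrieLength : ∀ {n} (M : Maniplex n) → Flag M → ℕ → Set
PetrieLength M Φ ℓ = Σ (List (Flag M)) λ xs →
  (length xs ≡ ℓ) × Unique xs × (∀ y → (y ∈ xs) ⇔ InPetrie M Φ y)

SimplePetrie : ∀ {n} (M : Maniplex n) → Flag M → Set
SimplePetrie M Φ = ∀ x y → InPetrie M Φ x → InPetrie M Φ y → x ≢ y → ¬ Same0Face M x y

{-# OPTIONS --safe #-}
module Submission where

-- Write i = b + a·n with b < n, so that Ψᵢ = r_{b-1}⋯r₀ ωᵃΦ. For b ≥ 1 the remaining steps
-- r_{n-1}⋯r_b use colours ≥ 1, so Ψᵢ lies in the 0-face of the Petrie flag ωᵃ⁺¹Φ; for b = 0 it
-- is the Petrie flag ωᵃΦ itself. If Ψᵢ = Ψⱼ, simplicity of the Petrie polygon forces these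
-- Petrie flags to coincide, and then the residues agree because, by the diamond condition, a
-- walk r_{d-1}⋯r_b with b < d ≤ n never returns to its start. Finally the quotients agree since
-- the ℓ flags Φ, ωΦ, …, ω^{ℓ-1}Φ are distinct.

open import Defs
open import Data.Nat using (ℕ; _*_; _<_)
open import Relation.Binary.PropositionalEquality using (_≡_)

open import Data.Nat using (zero; suc; _+_; _≤_; _≤′_; ≤′-refl; ≤′-step; z≤n; s≤s; _≟_)
open import Data.Nat.Properties
open import Data.Nat.DivMod using (_mod_; _%_; _/_; m%n<n; m<n⇒m%n≡m; [m+n]%n≡m%n; m≡m%n+[m/n]*n; m<n*o⇒m/o<n)
open import Data.Fin using (Fin; toℕ)
open import Data.Fin.Properties using (toℕ-fromℕ<; fromℕ<-cong; injective⇒≤)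
open import Data.Product using (_,_; proj₁; proj₂)
open import Data.List using (List; _∷_; length; lookup)
open import Data.List.Relation.Unary.Unique.Propositional using (Unique)
open import Data.List.Relation.Unary.AllPairs using (_∷_)
import Data.List.Relation.Unary.All as All
open import Data.List.Membership.Propositional.Properties using (∈-lookup)
open import Relation.Binary.PropositionalEquality
  using (_≢_; refl; sym; trans; cong; cong₂; subst; module ≡-Reasoning)
open import Relation.Binary.Definitions using (tri<; tri≈; tri>)
open import Relation.Nullary using (¬_; contradiction)
open import Relation.Nullary.Decidable using (decidable-stable)
open import Function using (Equivalence)

module _ {n : ℕ} {F : Set} {r : Fin n → F → F} where

  Path-map : ∀ {P Q : Fin n → Set} → (∀ {i} → P i → Q i) →
             ∀ {x y} → Path r P x y → Path r Q x y
  Path-map f here         = here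
  Path-map f (step i p q) = step i (f p) (Path-map f q)

  Path-++ : ∀ {P : Fin n → Set} {x y z} → Path r P x y → Path r P y z → Path r P x z
  Path-++ here         q′ = q′
  Path-++ (step i p q) q′ = step i p (Path-++ q q′)

  Path-reverse : ∀ {P : Fin n → Set} → (∀ i x → r i (r i x) ≡ x) →
                 ∀ {x y} → Path r P x y → Path r P y x
  Path-reverse involutive here = here
  Path-reverse {P} involutive {x} (step i p q) =
    Path-++ (Path-reverse involutive q)
            (step i p (subst (λ z → Path r P z x) (sym (involutive i x)) here))

  Path-without-colours : ∀ {P : Fin n → Set} → (∀ i → ¬ P i) →
                         ∀ {x y} → Path r P x y → x ≡ y
  Path-without-colours ¬P here         = refl
  Path-without-colours ¬P (step i p q) = contradiction p (¬P i)

Unique-lookup-injective : ∀ {A : Set} {xs : List A} → Unique xs →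
                          ∀ i j → lookup xs i ≡ lookup xs j → i ≡ j
Unique-lookup-injective (_ ∷ _)   Fin.zero    Fin.zero    _  = refl
Unique-lookup-injective (x≢ ∷ _)  Fin.zero    (Fin.suc j) eq = contradiction eq (All.lookup x≢ (∈-lookup j))
Unique-lookup-injective (x≢ ∷ _)  (Fin.suc i) Fin.zero    eq = contradiction (sym eq) (All.lookup x≢ (∈-lookup i))
Unique-lookup-injective (_ ∷ u)   (Fin.suc i) (Fin.suc j) eq = cong Fin.suc (Unique-lookup-injective u i j eq)

rmod-involutive : ∀ {n} (M : Maniplex n) q x → rmod M q (rmod M q x) ≡ x
rmod-involutive {zero}  M q x = refl
rmod-involutive {suc n} M q x = invol M (q mod suc n) x

rmod-periodic : ∀ {n} (M : Maniplex n) q → rmod M (q + n) ≡ rmod M q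
rmod-periodic {zero}  M q = refl
rmod-periodic {suc n} M q =
  cong (r M) (fromℕ<-cong _ _ ([m+n]%n≡m%n q (suc n)) (m%n<n (q + suc n) (suc n)) (m%n<n q (suc n)))

walk-injective : ∀ {n} (M : Maniplex n) k {x y} → walk M k x ≡ walk M k y → x ≡ y
walk-injective M zero    eq = eq
walk-injective M (suc k) {x} {y} eq = walk-injective M k (begin
  walk M k x                             ≡⟨ rmod-involutive M k (walk M k x) ⟨
  rmod M k (rmod M k (walk M k x))       ≡⟨ cong (rmod M k) eq ⟩
  rmod M k (rmod M k (walk M k y))       ≡⟨ rmod-involutive M k (walk M k y) ⟩
  walk M k y                             ∎)
  where open ≡-Reasoning

walk-+n : ∀ {n} (M : Maniplex n) q x → walk M (q + n) x ≡ walk M q (ω M x)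
walk-+n M zero    x = refl
walk-+n M (suc q) x = cong₂ (λ f y → f y) (rmod-periodic M q) (walk-+n M q x)

walk-ωpow : ∀ {n} (M : Maniplex n) b a x → walk M (b + a * n) x ≡ walk M b (ωpow M a x)
walk-ωpow M b zero x = cong (λ k → walk M k x) (+-identityʳ b)
walk-ωpow {n} M b (suc a) x = begin
  walk M (b + (n + a * n)) x         ≡⟨ cong (λ k → walk M k x) (+-assoc b n (a * n)) ⟨
  walk M (b + n + a * n) x           ≡⟨ walk-ωpow M (b + n) a x ⟩
  walk M (b + n) (ωpow M a x)        ≡⟨ walk-+n M b (ωpow M a x) ⟩
  walk M b (ωpow M (suc a) x)        ∎
  where open ≡-Reasoning

ω-injective : ∀ {n} (M : Maniplex n) {x y} → ω M x ≡ ω M y → x ≡ y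
ω-injective {n} M = walk-injective M n

ωpow-injective : ∀ {n} (M : Maniplex n) a {x y} → ωpow M a x ≡ ωpow M a y → x ≡ y
ωpow-injective M zero    eq = eq
ωpow-injective M (suc a) eq = ωpow-injective M a (ω-injective M eq)

ωpow-+ : ∀ {n} (M : Maniplex n) p q x → ωpow M (p + q) x ≡ ωpow M p (ωpow M q x)
ωpow-+ M zero    q x = refl
ωpow-+ M (suc p) q x = cong (ω M) (ωpow-+ M p q x)

ωpow-comm : ∀ {n} (M : Maniplex n) p q x → ωpow M p (ωpow M q x) ≡ ωpow M q (ωpow M p x)
ωpow-comm M p q x = begin
  ωpow M p (ωpow M q x)   ≡⟨ ωpow-+ M p q x ⟨
  ωpow M (p + q) x        ≡⟨ cong (λ k → ωpow M k x) (+-comm p q) ⟩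
  ωpow M (q + p) x        ≡⟨ ωpow-+ M q p x ⟩
  ωpow M q (ωpow M p x)   ∎
  where open ≡-Reasoning

InPetrie-ω : ∀ {n} (M : Maniplex n) {Φ x} → InPetrie M Φ x → InPetrie M Φ (ω M x)
InPetrie-ω M (k , ωᵏΦ≡x) = suc k , cong (ω M) ωᵏΦ≡x

module _ {n : ℕ} (M : Maniplex n) {Φ : Flag M} {p : ℕ} (period : ωpow M (suc p) Φ ≡ Φ) where

  ωpow-multiple-of-period : ∀ q → ωpow M (q * suc p) Φ ≡ Φ
  ωpow-multiple-of-period zero    = refl
  ωpow-multiple-of-period (suc q) = begin
    ωpow M (suc p + q * suc p) Φ          ≡⟨ ωpow-+ M (suc p) (q * suc p) Φ ⟩
    ωpow M (suc p) (ωpow M (q * suc p) Φ) ≡⟨ cong (ωpow M (suc p)) (ωpow-multiple-of-period q) ⟩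
    ωpow M (suc p) Φ                      ≡⟨ period ⟩
    Φ                                     ∎
    where open ≡-Reasoning

  ωpow-mod-period : ∀ k → ωpow M (k % suc p) Φ ≡ ωpow M k Φ
  ωpow-mod-period k = begin
    ωpow M (k % suc p) Φ                                 ≡⟨ cong (ωpow M (k % suc p)) (ωpow-multiple-of-period (k / suc p)) ⟨
    ωpow M (k % suc p) (ωpow M (k / suc p * suc p) Φ)    ≡⟨ ωpow-+ M (k % suc p) (k / suc p * suc p) Φ ⟨
    ωpow M (k % suc p + k / suc p * suc p) Φ             ≡⟨ cong (λ t → ωpow M t Φ) (m≡m%n+[m/n]*n k (suc p)) ⟨
    ωpow M k Φ                                           ∎
    where open ≡-Reasoning

  PetrieLength-≤-period : ∀ {ℓ} → PetrieLength M Φ ℓ → ℓ ≤ suc p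
  PetrieLength-≤-period (xs , refl , unique , members) = injective⇒≤ residue-injective
    where
      exponent : Fin (length xs) → ℕ
      exponent i = proj₁ (Equivalence.to (members (lookup xs i)) (∈-lookup i))

      residue : Fin (length xs) → Fin (suc p)
      residue i = exponent i mod suc p

      ωpow-residue : ∀ i → ωpow M (toℕ (residue i)) Φ ≡ lookup xs i
      ωpow-residue i = begin
        ωpow M (toℕ (residue i)) Φ    ≡⟨ cong (λ t → ωpow M t Φ) (toℕ-fromℕ< (m%n<n (exponent i) (suc p))) ⟩
        ωpow M (exponent i % suc p) Φ ≡⟨ ωpow-mod-period (exponent i) ⟩
        ωpow M (exponent i) Φ         ≡⟨ proj₂ (Equivalence.to (members (lookup xs i)) (∈-lookup i)) ⟩
        lookup xs i                   ∎
        where open ≡-Reasoning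

      residue-injective : ∀ {i j} → residue i ≡ residue j → i ≡ j
      residue-injective {i} {j} eq = Unique-lookup-injective unique i j (begin
        lookup xs i                   ≡⟨ ωpow-residue i ⟨
        ωpow M (toℕ (residue i)) Φ    ≡⟨ cong (λ t → ωpow M (toℕ t) Φ) eq ⟩
        ωpow M (toℕ (residue j)) Φ    ≡⟨ ωpow-residue j ⟩
        lookup xs j                   ∎)
        where open ≡-Reasoning

ωpow-distinct-below-PetrieLength : ∀ {n} (M : Maniplex n) {Φ ℓ} → PetrieLength M Φ ℓ →
  ∀ {a c} → a < c → c < ℓ → ωpow M a Φ ≢ ωpow M c Φ
ωpow-distinct-below-PetrieLength M {Φ} length-ℓ {a} a<c c<ℓ eq with m≤n⇒∃[o]m+o≡n a<c
... | k , refl = <⇒≱ c<ℓ (≤-trans (PetrieLength-≤-period M period length-ℓ) (s≤s (m≤n+m k a)))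
  where
    open ≡-Reasoning
    period : ωpow M (suc k) Φ ≡ Φ
    period = ωpow-injective M a (begin
      ωpow M a (ωpow M (suc k) Φ)   ≡⟨ ωpow-comm M a (suc k) Φ ⟩
      ωpow M (suc k) (ωpow M a Φ)   ≡⟨ ωpow-+ M (suc k) a Φ ⟨
      ωpow M (suc k + a) Φ          ≡⟨ cong (λ t → ωpow M (suc t) Φ) (+-comm k a) ⟩
      ωpow M (suc a + k) Φ          ≡⟨ eq ⟨
      ωpow M a Φ                    ∎)

ωpow-injective-below-PetrieLength : ∀ {n} (M : Maniplex n) {Φ ℓ} → PetrieLength M Φ ℓ →
  ∀ {a c} → a < ℓ → c < ℓ → ωpow M a Φ ≡ ωpow M c Φ → a ≡ c
ωpow-injective-below-PetrieLength M length-ℓ {a} {c} a<ℓ c<ℓ eq with <-cmp a c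
... | tri< a<c _ _ = contradiction eq (ωpow-distinct-below-PetrieLength M length-ℓ a<c c<ℓ)
... | tri≈ _ a≡c _ = a≡c
... | tri> _ _ c<a = contradiction (sym eq) (ωpow-distinct-below-PetrieLength M length-ℓ c<a a<ℓ)

module _ {n′ : ℕ} (M : Maniplex (suc n′)) where

  private
    n : ℕ
    n = suc n′

  toℕ-mod-< : ∀ {q} → q < n → toℕ (q mod n) ≡ q
  toℕ-mod-< {q} q<n = trans (toℕ-fromℕ< (m%n<n q n)) (m<n⇒m%n≡m q<n)

  walk-Path : ∀ {b d} X → b ≤′ d → d ≤ n →
              Path (r M) (λ i → b ≤ toℕ i) (walk M b X) (walk M d X)
  walk-Path X ≤′-refl _ = here
  walk-Path X (≤′-step {d} b≤′d) d<n =
    Path-++ (walk-Path X b≤′d (<⇒≤ d<n))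
            (step (d mod n) (≤-trans (≤′⇒≤ b≤′d) (≤-reflexive (sym (toℕ-mod-< d<n)))) here)

  walk-Same0Face-ω : ∀ {b} X → 1 ≤ b → b ≤ n → Same0Face M (walk M b X) (ω M X)
  walk-Same0Face-ω X 1≤b b≤n = Path-map (≤-trans 1≤b) (walk-Path X (≤⇒≤′ b≤n) ≤-refl)

  -- The diamond condition joins w = r_b Ψ_b to r_b w both by the colour-b edge and, along the
  -- rest of the returning walk, by colours above b; hence by a path with no colours at all.
  walk-no-return : IsPolytope M → ∀ {b d} X → b < d → d ≤ n → walk M d X ≢ walk M b X
  walk-no-return polytope {b} X b<d d≤n returns = noLoop M (b mod n) w (sym w≡rᵦw)
    where
      w : Flag M
      w = walk M (suc b) X

      down : Path (r M) (λ i → toℕ i ≤ b) w (r M (b mod n) w)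
      down = step (b mod n) (≤-reflexive (toℕ-mod-< (≤-trans b<d d≤n))) here

      up : Path (r M) (λ i → suc b ≤ toℕ i) w (r M (b mod n) w)
      up = subst (Path (r M) _ w) (trans returns (sym (invol M (b mod n) (walk M b X))))
                 (walk-Path X (≤⇒≤′ b<d) d≤n)

      w≡rᵦw : w ≡ r M (b mod n) w
      w≡rᵦw = Path-without-colours (λ i (b<i , i≤b) → <⇒≱ b<i i≤b) (polytope (suc b) b w _ down up)

  walk-index-injective : IsPolytope M → ∀ {b d} X → b ≤ n → d ≤ n →
                         walk M b X ≡ walk M d X → b ≡ d
  walk-index-injective polytope {b} {d} X b≤n d≤n eq with <-cmp b d
  ... | tri< b<d _ _ = contradiction (sym eq) (walk-no-return polytope X b<d d≤n)
  ... | tri≈ _ b≡d _ = b≡d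
  ... | tri> _ _ d<b = contradiction eq (walk-no-return polytope X d<b b≤n)

  module _ (polytope : IsPolytope M) {Φ : Flag M} (simple : SimplePetrie M Φ) where

    InPetrie-≢-walk : ∀ {X Y d} → InPetrie M Φ X → InPetrie M Φ Y → suc d < n →
                      X ≢ walk M (suc d) Y
    InPetrie-≢-walk {X} {Y} inX inY 1+d<n X≡walk =
      simple X (ω M Y) inX (InPetrie-ω M inY) X≢ωY
        (subst (λ z → Same0Face M z (ω M Y)) (sym X≡walk) (walk-Same0Face-ω Y (s≤s z≤n) (<⇒≤ 1+d<n)))
      where
        X≢ωY : X ≢ ω M Y
        X≢ωY X≡ωY = walk-no-return polytope Y 1+d<n ≤-refl (trans (sym X≡ωY) X≡walk)

    walk-residue-unique : ∀ {X Y b d} → InPetrie M Φ X → InPetrie M Φ Y → b < n → d < n →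
                          walk M b X ≡ walk M d Y → b ≡ d
    walk-residue-unique {b = zero}  {zero}  _   _   _   _   _  = refl
    walk-residue-unique {b = zero}  {suc d} inX inY _   d<n eq =
      contradiction eq (InPetrie-≢-walk inX inY d<n)
    walk-residue-unique {b = suc b} {zero}  inX inY b<n _   eq =
      contradiction (sym eq) (InPetrie-≢-walk inY inX b<n)
    walk-residue-unique {X} {Y} {suc b} {suc d} inX inY b<n d<n eq =
      decidable-stable (suc b ≟ suc d) λ b≢d →
        simple (ω M X) (ω M Y) (InPetrie-ω M inX) (InPetrie-ω M inY) (ωX≢ωY b≢d) ωX~ωY
      where
        ωX~ωY : Same0Face M (ω M X) (ω M Y)
        ωX~ωY = Path-++ (Path-reverse (invol M) (walk-Same0Face-ω X (s≤s z≤n) (<⇒≤ b<n)))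
                        (subst (λ z → Same0Face M z (ω M Y)) (sym eq)
                               (walk-Same0Face-ω Y (s≤s z≤n) (<⇒≤ d<n)))

        ωX≢ωY : suc b ≢ suc d → ω M X ≢ ω M Y
        ωX≢ωY b≢d ωX≡ωY = b≢d (walk-index-injective polytope X (<⇒≤ b<n) (<⇒≤ d<n)
          (trans eq (cong (walk M (suc d)) (sym (ω-injective M ωX≡ωY)))))

lemma6p2 : ∀ (n : ℕ) (M : Maniplex n) → IsPolytope M →
    ∀ (Φ : Flag M) (ℓ : ℕ) → PetrieLength M Φ ℓ → SimplePetrie M Φ →
    ∀ (i j : ℕ) → i < n * ℓ → j < n * ℓ → walk M i Φ ≡ walk M j Φ → i ≡ j
lemma6p2 zero M _ Φ ℓ _ _ i j () _ _
lemma6p2 n@(suc _) M polytope Φ ℓ length-ℓ simple i j i<nℓ j<nℓ walkᵢ≡walkⱼ = begin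
  i                       ≡⟨ m≡m%n+[m/n]*n i n ⟩
  i % n + (i / n) * n     ≡⟨ cong₂ (λ b a → b + a * n) residues quotients ⟩
  j % n + (j / n) * n     ≡⟨ m≡m%n+[m/n]*n j n ⟨
  j                       ∎
  where
    open ≡-Reasoning

    split : ∀ k → walk M k Φ ≡ walk M (k % n) (ωpow M (k / n) Φ)
    split k = trans (cong (λ t → walk M t Φ) (m≡m%n+[m/n]*n k n)) (walk-ωpow M (k % n) (k / n) Φ)

    split-walks : walk M (i % n) (ωpow M (i / n) Φ) ≡ walk M (j % n) (ωpow M (j / n) Φ)
    split-walks = trans (sym (split i)) (trans walkᵢ≡walkⱼ (split j))

    residues : i % n ≡ j % n
    residues = walk-residue-unique M polytope simple (i / n , refl) (j / n , refl)
                 (m%n<n i n) (m%n<n j n) split-walks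

    quotient< : ∀ {k} → k < n * ℓ → k / n < ℓ
    quotient< {k} k<nℓ = m<n*o⇒m/o<n (subst (k <_) (*-comm n ℓ) k<nℓ)

    quotients : i / n ≡ j / n
    quotients = ωpow-injective-below-PetrieLength M length-ℓ (quotient< i<nℓ) (quotient< j<nℓ)
                  (walk-injective M (j % n)
                    (trans (cong (λ b → walk M b (ωpow M (i / n) Φ)) (sym residues)) split-walks))
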